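{- For every integer $m\ge 2$, $\pi_f(K_{m,m})=\frac{3m}{m+1}$.
   Context: Two edges are nonincident if they share no endpoint. A linear ordering of $V(G)$ separates a pair of nonincident edges if both endpoints of one edge precede both endpoints of the other. $\pi_t(G)$ is the minimum length of a list of linear orderings of $V(G)$ (repetitions allowed) separating every pair of nonincident edges at least $t$ times, and the fractional separation dimension is $\pi_f(G)=\liminf_{t\to\infty}\pi_t(G)/t$ (equivalently the minimum of $a/b$ over lists of $a$ orderings separating every nonincident pair at least $b$ times). $K_{m,m}$ is the complete bipartite graph with parts of size $m$. -}

module Defs where

open import Data.Nat using (ℕ; _≤_; _*_; _+_)
open import Data.Fin using (Fin; _<_; _<?_)
open import Data.Sum using (_⊎_; inj₁; inj₂)
open import Data.Product using (_×_; _,_; Σ; ∃)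
open import Data.List using (List; length; filter)
open import Function.Bundles using (_↔_; Inverse)
open import Relation.Binary.PropositionalEquality using (_≡_; _≢_)
open import Relation.Nullary.Decidable using (Dec; _×-dec_; _⊎-dec_)

Vertex : ℕ → Set
Vertex m = Fin m ⊎ Fin m

-- Edges of K_{m,m}: exactly the pairs {inj₁ i , inj₂ j}; the edge is coded by (i , j).
Edge : ℕ → Set
Edge m = Fin m × Fin m

endL : ∀ {m} → Edge m → Vertex m
endL (i , _) = inj₁ i

endR : ∀ {m} → Edge m → Vertex m
endR (_ , j) = inj₂ j

Nonincident : ∀ {m} → Edge m → Edge m → Set
Nonincident (i , j) (i' , j') = (i ≢ i') × (j ≢ j')

Ordering : ℕ → Set
Ordering m = Vertex m ↔ Fin (m + m)

pos : ∀ {m} → Ordering m → Vertex m → Fin (m + m)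
pos σ = Inverse.to σ

Precedes : ∀ {m} → Ordering m → Edge m → Edge m → Set
Precedes σ e f =
  (pos σ (endL e) < pos σ (endL f)) × (pos σ (endL e) < pos σ (endR f)) ×
  (pos σ (endR e) < pos σ (endL f)) × (pos σ (endR e) < pos σ (endR f))

precedes? : ∀ {m} (σ : Ordering m) (e f : Edge m) → Dec (Precedes σ e f)
precedes? σ e f =
  (pos σ (endL e) <? pos σ (endL f)) ×-dec (pos σ (endL e) <? pos σ (endR f)) ×-dec
  (pos σ (endR e) <? pos σ (endL f)) ×-dec (pos σ (endR e) <? pos σ (endR f))

Separates : ∀ {m} → Edge m → Edge m → Ordering m → Set
Separates e f σ = Precedes σ e f ⊎ Precedes σ f e

separates? : ∀ {m} (e f : Edge m) (σ : Ordering m) → Dec (Separates e f σ)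
separates? e f σ = precedes? σ e f ⊎-dec precedes? σ f e

sepCount : ∀ {m} → List (Ordering m) → Edge m → Edge m → ℕ
sepCount L e f = length (filter (separates? e f) L)

SeparatesAll : ∀ {m} → List (Ordering m) → ℕ → Set
SeparatesAll {m} L b = (e f : Edge m) → Nonincident e f → b ≤ sepCount L e f

-- π_f(K_{m,m}) = p / q, using π_f = min { a/b : some list of a orderings separates
-- every nonincident pair at least b times, b ≥ 1 }:
-- the value p/q is attained, and every such a/b is ≥ p/q.
FracSepDimIs : ℕ → ℕ → ℕ → Set
FracSepDimIs m p q =
  (Σ (List (Ordering m)) λ L → Σ ℕ λ b →
     (1 ≤ b) × SeparatesAll L b × (length L * q ≡ p * b))
  × ((L : List (Ordering m)) (b : ℕ) → 1 ≤ b → SeparatesAll L b → p * b ≤ length L * q)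

module Submission where

-- Put the left vertices at the even positions 2π(a) and the right vertices at the
-- odd positions 2ρ(c) + 1, for all (m!)² pairs of permutations π, ρ.  Averaging over π and ρ
-- every nonincident pair is separated equally often: (m − 2)!² times the number of separated
-- pairs in one alternating ordering, which is m(m − 1)²(m + 1)/3.
--
-- Read an ordering from left to right as a walk from (0 , 0) to (m , m) that
-- counts the left and right vertices seen so far.  A vertex at position t is the later end of
-- the edges joining it to the earlier vertices of the other side, and each of them precedes
-- exactly the edges lying entirely after t.  A polynomial potential Φ dominates six times the
-- accumulated count step by step, so an ordering has at most Φ(m , m) / 6 = m(m − 1)²(m + 1)/6
-- ordered preceding pairs.  Double counting over the m²(m − 1)² ordered nonincident pairs gives
-- 3mb ≤ a(m + 1) for a orderings separating every pair b times.

open import Defs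
open import Data.Bool using (Bool; true; false; _∧_; _∨_)
open import Data.Bool.Properties using (∧-identityʳ; ∧-zeroʳ; ∧-assoc)
open import Data.Empty using (⊥-elim)
open import Data.Fin using (Fin; zero; suc; toℕ; punchIn; cast; fromℕ<)
open import Data.Fin.Permutation using (Permutation′; insert; _⟨$⟩ʳ_) renaming (id to idₚ)
open import Data.Fin.Properties using (punchInᵢ≢i; toℕ<n; toℕ-inject₁; toℕ-fromℕ; toℕ-fromℕ<; toℕ-injective; *↔×; cast-involutive; toℕ-cast; toℕ-combine)
open import Data.List using (List; []; _∷_; _++_; length; map; concatMap; allFin; tabulate; filter)
open import Data.Nat hiding (Ordering; _<?_)
open import Data.Nat.Properties
open import Data.Nat.Tactic.RingSolver using (solve-∀; solve)
open import Data.Product using (Σ; _×_; _,_; proj₁; proj₂)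
import Data.Integer as ℤ
open ℤ using (ℤ)
import Data.Integer.Properties as ℤₚ
open import Data.Integer.Solver using (module +-*-Solver)
open +-*-Solver using (Polynomial; con; var; _:+_; _:*_; _:-_; _:^_; ⟦_⟧; _:=_) renaming (solve to solveℤ)
open import Data.Sum using (_⊎_; inj₁; inj₂)
open import Data.Sum.Properties using (inj₁-injective; inj₂-injective)
open import Data.Sum.Function.Propositional using (_⊎-↔_)
open import Function using (_∘_; case_of_; _↔_; mk↔ₛ′; Inverse)
open import Function.Construct.Composition using (_↔-∘_)
open import Function.Construct.Symmetry using (↔-sym)
open import Relation.Binary.PropositionalEquality using (_≡_; _≢_; refl; sym; trans; cong; cong₂; subst; module ≡-Reasoning)
open import Relation.Binary.Definitions using (tri<; tri≈; tri>)
open import Relation.Nullary using (Dec; yes; no; does)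
open import Algebra.Properties.Semiring.Sum +-*-semiring
  using (sum; sum-syntax; sum-cong-≗; ∑-distrib-+; ∑-comm; sum-remove; sum-init-last; *-distribˡ-sum; *-distribʳ-sum)

𝟙 : Bool → ℕ
𝟙 true  = 1
𝟙 false = 0

𝟙-∧ : ∀ a b → 𝟙 (a ∧ b) ≡ 𝟙 a * 𝟙 b
𝟙-∧ true  b = sym (+-identityʳ (𝟙 b))
𝟙-∧ false b = refl

𝟙-∨ : ∀ a b → (a ≡ true → b ≡ false) → 𝟙 (a ∨ b) ≡ 𝟙 a + 𝟙 b
𝟙-∨ true  b a⇒¬b rewrite a⇒¬b refl = refl
𝟙-∨ false b _ = refl

<ᵇ-true : ∀ {x y} → x < y → (x <ᵇ y) ≡ true
<ᵇ-true z<s       = refl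
<ᵇ-true {suc x} {suc y} (s<s x<y) = <ᵇ-true {x} {y} x<y

<ᵇ-false : ∀ {x y} → y ≤ x → (x <ᵇ y) ≡ false
<ᵇ-false z≤n       = refl
<ᵇ-false (s≤s y≤x) = <ᵇ-false y≤x

<ᵇ-cong : ∀ {x y u v} → (x < y → u < v) → (u < v → x < y) → (x <ᵇ y) ≡ (u <ᵇ v)
<ᵇ-cong {x} {y} to from with x <? y
... | yes x<y = trans (<ᵇ-true x<y) (sym (<ᵇ-true (to x<y)))
... | no  x≮y = trans (<ᵇ-false (≮⇒≥ x≮y)) (sym (<ᵇ-false (≮⇒≥ (x≮y ∘ from))))

⊔-<ᵇ : ∀ x y u → (x <ᵇ u) ∧ (y <ᵇ u) ≡ (x ⊔ y <ᵇ u)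
⊔-<ᵇ x       y       zero    = refl
⊔-<ᵇ zero    y       (suc u) = refl
⊔-<ᵇ (suc x) zero    (suc u) = ∧-identityʳ (x <ᵇ u)
⊔-<ᵇ (suc x) (suc y) (suc u) = ⊔-<ᵇ x y u

⊓-<ᵇ : ∀ x a b → (x <ᵇ a) ∧ (x <ᵇ b) ≡ (x <ᵇ a ⊓ b)
⊓-<ᵇ x       zero    b       = refl
⊓-<ᵇ x       (suc a) zero    = ∧-zeroʳ (x <ᵇ suc a)
⊓-<ᵇ zero    (suc a) (suc b) = refl
⊓-<ᵇ (suc x) (suc a) (suc b) = ⊓-<ᵇ x a b

∧-interchange : ∀ a b c d → a ∧ (b ∧ (c ∧ d)) ≡ (a ∧ c) ∧ (b ∧ d)
∧-interchange false b     c     d = refl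
∧-interchange true  false c     d = sym (∧-zeroʳ c)
∧-interchange true  true  c     d = refl

𝟙-<ᵇ-suc : ∀ x t → 𝟙 (x <ᵇ suc t) ≡ 𝟙 (x <ᵇ t) + 𝟙 (x ≡ᵇ t)
𝟙-<ᵇ-suc zero    zero    = refl
𝟙-<ᵇ-suc zero    (suc t) = refl
𝟙-<ᵇ-suc (suc x) zero    = refl
𝟙-<ᵇ-suc (suc x) (suc t) = 𝟙-<ᵇ-suc x t

𝟙-trichotomy : ∀ x t → 𝟙 (x <ᵇ t) + 𝟙 (t <ᵇ x) + 𝟙 (x ≡ᵇ t) ≡ 1
𝟙-trichotomy zero    zero    = refl
𝟙-trichotomy zero    (suc t) = refl
𝟙-trichotomy (suc x) zero    = refl
𝟙-trichotomy (suc x) (suc t) = 𝟙-trichotomy x t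

𝟙-≡ᵇ-refl : ∀ x → 𝟙 (x ≡ᵇ x) ≡ 1
𝟙-≡ᵇ-refl zero    = refl
𝟙-≡ᵇ-refl (suc x) = 𝟙-≡ᵇ-refl x

𝟙-≡ᵇ-≢ : ∀ x t → x ≢ t → 𝟙 (x ≡ᵇ t) ≡ 0
𝟙-≡ᵇ-≢ zero    zero    x≢t = ⊥-elim (x≢t refl)
𝟙-≡ᵇ-≢ zero    (suc t) _   = refl
𝟙-≡ᵇ-≢ (suc x) zero    _   = refl
𝟙-≡ᵇ-≢ (suc x) (suc t) x≢t = 𝟙-≡ᵇ-≢ x t (x≢t ∘ cong suc)

𝟙-≡ᵇ-subst : ∀ x t (f : ℕ → ℕ) → 𝟙 (x ≡ᵇ t) * f x ≡ 𝟙 (x ≡ᵇ t) * f t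
𝟙-≡ᵇ-subst zero    zero    f = refl
𝟙-≡ᵇ-subst zero    (suc t) f = refl
𝟙-≡ᵇ-subst (suc x) zero    f = refl
𝟙-≡ᵇ-subst (suc x) (suc t) f = 𝟙-≡ᵇ-subst x t (f ∘ suc)

+-≡1-cases : ∀ {x y} → x + y ≡ 1 → (x ≡ 1 × y ≡ 0) ⊎ (x ≡ 0 × y ≡ 1)
+-≡1-cases {zero}        x+y≡1 = inj₂ (refl , x+y≡1)
+-≡1-cases {suc zero}    x+y≡1 = inj₁ (refl , suc-injective x+y≡1)
+-≡1-cases {suc (suc x)} ()

max-split : ∀ x y (F : ℕ → ℕ) → x ≢ y → F (x ⊔ y) ≡ 𝟙 (y <ᵇ x) * F x + 𝟙 (x <ᵇ y) * F y
max-split x y F x≢y with <-cmp x y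
... | tri< x<y _ _ rewrite m≤n⇒m⊔n≡n (<⇒≤ x<y) | <ᵇ-false (<⇒≤ x<y) | <ᵇ-true x<y = sym (+-identityʳ (F y))
... | tri≈ _ x≡y _ = ⊥-elim (x≢y x≡y)
... | tri> _ _ y<x rewrite m≥n⇒m⊔n≡m (<⇒≤ y<x) | <ᵇ-false (<⇒≤ y<x) | <ᵇ-true y<x =
  trans (sym (+-identityʳ (F x))) (sym (+-identityʳ (F x + 0)))

sum-const : ∀ n c → ∑[ i < n ] c ≡ n * c
sum-const zero    c = refl
sum-const (suc n) c = cong (c +_) (sum-const n c)

sum-zero : ∀ n {f : Fin n → ℕ} → (∀ i → f i ≡ 0) → sum f ≡ 0
sum-zero n f≡0 = trans (sum-cong-≗ f≡0) (trans (sum-const n 0) (*-zeroʳ n))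

sum-mono : ∀ {n} {f g : Fin n → ℕ} → (∀ i → f i ≤ g i) → sum f ≤ sum g
sum-mono {zero}  _   = z≤n
sum-mono {suc n} f≤g = +-mono-≤ (f≤g zero) (sum-mono (f≤g ∘ suc))

sum-skip : ∀ {n} (j : Fin (suc n)) {f : Fin (suc n) → ℕ} → f j ≡ 0 → sum (f ∘ punchIn j) ≡ sum f
sum-skip j {f} fj≡0 = sym (trans (sum-remove {i = j} f) (cong (_+ sum (f ∘ punchIn j)) fj≡0))

sum-point : ∀ {n} (k : Fin n) {f : Fin n → ℕ} → (∀ i → i ≢ k → f i ≡ 0) → sum f ≡ f k
sum-point {suc n} k {f} off-k = begin
  sum f                          ≡⟨ sum-remove {i = k} f ⟩
  f k + sum (f ∘ punchIn k)      ≡⟨ cong (f k +_) (sum-zero n (λ i → off-k _ (punchInᵢ≢i k i))) ⟩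
  f k + 0                        ≡⟨ +-identityʳ (f k) ⟩
  f k                            ∎
  where open ≡-Reasoning

sum-punchIn-≤ : ∀ {n} (j : Fin (suc n)) (f : Fin (suc n) → ℕ) → sum (f ∘ punchIn j) ≤ sum f
sum-punchIn-≤ j f = subst (sum (f ∘ punchIn j) ≤_) (sym (sum-remove f)) (m≤n+m _ (f j))

∑-*-∑ : ∀ {m n} (f : Fin m → ℕ) (g : Fin n → ℕ) → sum f * sum g ≡ ∑[ i < m ] ∑[ j < n ] (f i * g j)
∑-*-∑ f g = trans (*-distribʳ-sum (sum g) f) (sum-cong-≗ (λ i → *-distribˡ-sum (f i) g))

∑-<ᵇ : ∀ n k → k ≤ n → ∑[ x < n ] 𝟙 (toℕ x <ᵇ k) ≡ k
∑-<ᵇ n       zero    _         = sum-zero n (λ _ → refl)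
∑-<ᵇ (suc n) (suc k) (s≤s k≤n) = cong suc (∑-<ᵇ n k k≤n)

∑-toℕ-last : ∀ n (f : ℕ → ℕ) → ∑[ i < suc n ] f (toℕ i) ≡ ∑[ i < n ] f (toℕ i) + f n
∑-toℕ-last n f = trans (sum-init-last {n} (f ∘ toℕ))
  (cong₂ _+_ (sum-cong-≗ {n} (cong f ∘ toℕ-inject₁)) (cong f (toℕ-fromℕ n)))

∑-square : ∀ k → 6 * ∑[ i < suc k ] (toℕ i * toℕ i) ≡ k * suc k * (1 + 2 * k)
∑-square zero    = refl
∑-square (suc k) = begin
  6 * ∑[ i < 2 + k ] (toℕ i * toℕ i)                     ≡⟨ cong (6 *_) (∑-toℕ-last (suc k) (λ i → i * i)) ⟩
  6 * (∑[ i < suc k ] (toℕ i * toℕ i) + suc k * suc k)   ≡⟨ *-distribˡ-+ 6 (∑[ i < suc k ] (toℕ i * toℕ i)) (suc k * suc k) ⟩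
  6 * ∑[ i < suc k ] (toℕ i * toℕ i) + 6 * (suc k * suc k) ≡⟨ cong (_+ 6 * (suc k * suc k)) (∑-square k) ⟩
  k * suc k * (1 + 2 * k) + 6 * (suc k * suc k)          ≡⟨ solve (k ∷ []) ⟩
  suc k * (2 + k) * (1 + 2 * suc k)                      ∎
  where open ≡-Reasoning

∑-pronic : ∀ k → 3 * ∑[ i < suc k ] (suc (toℕ i) * toℕ i) ≡ k * suc k * (2 + k)
∑-pronic zero    = refl
∑-pronic (suc k) = begin
  3 * ∑[ i < 2 + k ] (suc (toℕ i) * toℕ i)                       ≡⟨ cong (3 *_) (∑-toℕ-last (suc k) (λ i → suc i * i)) ⟩
  3 * (∑[ i < suc k ] (suc (toℕ i) * toℕ i) + (2 + k) * suc k)   ≡⟨ *-distribˡ-+ 3 (∑[ i < suc k ] (suc (toℕ i) * toℕ i)) ((2 + k) * suc k) ⟩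
  3 * ∑[ i < suc k ] (suc (toℕ i) * toℕ i) + 3 * ((2 + k) * suc k) ≡⟨ cong (_+ 3 * ((2 + k) * suc k)) (∑-pronic k) ⟩
  k * suc k * (2 + k) + 3 * ((2 + k) * suc k)                    ≡⟨ solve (k ∷ []) ⟩
  suc k * (2 + k) * (3 + k)                                      ∎
  where open ≡-Reasoning

-- Each index i is hit by punchIn j for the n indices j other than i.
∑-sum-punchIn : ∀ n (f : Fin (suc n) → ℕ) → ∑[ j < suc n ] sum (f ∘ punchIn j) ≡ n * sum f
∑-sum-punchIn n f = +-cancelʳ-≡ (sum f) _ _ (begin
  ∑[ j < suc n ] sum (f ∘ punchIn j) + sum f            ≡⟨ ∑-distrib-+ (λ j → sum (f ∘ punchIn j)) f ⟨
  ∑[ j < suc n ] (sum (f ∘ punchIn j) + f j)            ≡⟨ sum-cong-≗ (λ j → trans (+-comm _ (f j)) (sym (sum-remove f))) ⟩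
  ∑[ j < suc n ] sum f                                  ≡⟨ sum-const (suc n) (sum f) ⟩
  suc n * sum f                                         ≡⟨ +-comm (sum f) (n * sum f) ⟩
  n * sum f + sum f                                     ∎)
  where open ≡-Reasoning

∑-sum-punchIn₂ : ∀ n (h : Fin (2 + n) → Fin (2 + n) → ℕ) → (∀ x → h x x ≡ 0) →
  ∑[ j < 2 + n ] ∑[ x < 1 + n ] ∑[ y < 1 + n ] h (punchIn j x) (punchIn j y)
    ≡ n * ∑[ x < 2 + n ] ∑[ y < 2 + n ] h x y
∑-sum-punchIn₂ n h h-diag = cancel (∑[ j < 2 + n ] inner j) T n (begin
  ∑[ j < 2 + n ] inner j + T + T                       ≡⟨ cong (∑[ j < 2 + n ] inner j + T +_) (∑-comm h) ⟩
  ∑[ j < 2 + n ] inner j + T + ∑[ j < 2 + n ] C j      ≡⟨ cong (_+ ∑[ j < 2 + n ] C j) (∑-distrib-+ inner R) ⟨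
  ∑[ j < 2 + n ] (inner j + R j) + ∑[ j < 2 + n ] C j  ≡⟨ ∑-distrib-+ (λ j → inner j + R j) C ⟨
  ∑[ j < 2 + n ] (inner j + R j + C j)                 ≡⟨ sum-cong-≗ row+column ⟩
  ∑[ j < 2 + n ] T                                     ≡⟨ sum-const (2 + n) T ⟩
  (2 + n) * T                                          ∎)
  where
  open ≡-Reasoning
  T = ∑[ x < 2 + n ] ∑[ y < 2 + n ] h x y
  R C inner : Fin (2 + n) → ℕ
  R x = ∑[ y < 2 + n ] h x y
  C y = ∑[ x < 2 + n ] h x y
  inner j = ∑[ x < 1 + n ] ∑[ y < 1 + n ] h (punchIn j x) (punchIn j y)
  row+column : ∀ j → inner j + R j + C j ≡ T
  row+column j = begin
    inner j + R j + C j                                             ≡⟨ cong (_+ C j) (+-comm (inner j) (R j)) ⟩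
    R j + inner j + C j                                             ≡⟨ cong (λ r → r + inner j + C j) (sum-skip j {h j} (h-diag j)) ⟨
    ∑[ y < 1 + n ] h j (punchIn j y) + inner j + C j                ≡⟨ cong (_+ C j) (sum-remove (λ x → ∑[ y < 1 + n ] h x (punchIn j y))) ⟨
    ∑[ x < 2 + n ] ∑[ y < 1 + n ] h x (punchIn j y) + C j           ≡⟨ cong (_+ C j) (∑-comm (λ x y → h x (punchIn j y))) ⟩
    ∑[ y < 1 + n ] C (punchIn j y) + C j                            ≡⟨ +-comm _ (C j) ⟩
    C j + ∑[ y < 1 + n ] C (punchIn j y)                            ≡⟨ sum-remove C ⟨
    ∑[ y < 2 + n ] C y                                              ≡⟨ ∑-comm h ⟨
    T                                                               ∎
  cancel : ∀ x t n → x + t + t ≡ (2 + n) * t → x ≡ n * t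
  cancel x t n eq = +-cancelʳ-≡ t x (n * t) (+-cancelʳ-≡ t (x + t) (n * t + t)
    (trans eq (rearrange n t)))
    where rearrange : ∀ n t → (2 + n) * t ≡ n * t + t + t
          rearrange = solve-∀

∑⁴ : ∀ {n} → (Fin n → Fin n → Fin n → Fin n → ℕ) → ℕ
∑⁴ {n} f = ∑[ x < n ] ∑[ y < n ] ∑[ u < n ] ∑[ v < n ] f x y u v

∑⁴-cong : ∀ {n} {f g : Fin n → Fin n → Fin n → Fin n → ℕ} → (∀ x y u v → f x y u v ≡ g x y u v) → ∑⁴ f ≡ ∑⁴ g
∑⁴-cong {n} f≗g = sum-cong-≗ {n} λ x → sum-cong-≗ {n} λ y → sum-cong-≗ {n} λ u → sum-cong-≗ {n} λ v → f≗g x y u v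

∑⁴-distrib-+ : ∀ {n} (f g : Fin n → Fin n → Fin n → Fin n → ℕ) →
  ∑⁴ (λ x y u v → f x y u v + g x y u v) ≡ ∑⁴ f + ∑⁴ g
∑⁴-distrib-+ {n} f g = trans
  (sum-cong-≗ {n} λ x → trans (sum-cong-≗ {n} λ y → trans (sum-cong-≗ {n} λ u → ∑-distrib-+ {n} _ _) (∑-distrib-+ {n} _ _)) (∑-distrib-+ {n} _ _))
  (∑-distrib-+ {n} _ _)

∑⁴-swap : ∀ {n} (f : Fin n → Fin n → Fin n → Fin n → ℕ) → ∑⁴ (λ x y u v → f y x v u) ≡ ∑⁴ f
∑⁴-swap {n} f = trans (∑-comm {n} {n} _) (sum-cong-≗ {n} λ y → sum-cong-≗ {n} λ x → ∑-comm {n} {n} _)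

∑-vertex-point : ∀ {m} (v₀ : Vertex m) (f : Vertex m → ℕ) → (∀ v → v ≢ v₀ → f v ≡ 0) →
  ∑[ a < m ] f (inj₁ a) + ∑[ c < m ] f (inj₂ c) ≡ f v₀
∑-vertex-point {m} (inj₁ a₀) f off =
  trans (cong₂ _+_ (sum-point a₀ (λ a a≢a₀ → off (inj₁ a) (a≢a₀ ∘ inj₁-injective)))
                   (sum-zero m (λ c → off (inj₂ c) λ ())))
        (+-identityʳ _)
∑-vertex-point {m} (inj₂ c₀) f off =
  cong₂ _+_ (sum-zero m (λ a → off (inj₁ a) λ ()))
            (sum-point c₀ (λ c c≢c₀ → off (inj₂ c) (c≢c₀ ∘ inj₂-injective)))

sumOver : ∀ {a} {A : Set a} → List A → (A → ℕ) → ℕ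
sumOver []       f = 0
sumOver (x ∷ xs) f = f x + sumOver xs f

module _ {a} {A : Set a} where

  sumOver-cong : (xs : List A) {f g : A → ℕ} → (∀ x → f x ≡ g x) → sumOver xs f ≡ sumOver xs g
  sumOver-cong []       f≗g = refl
  sumOver-cong (x ∷ xs) f≗g = cong₂ _+_ (f≗g x) (sumOver-cong xs f≗g)

  sumOver-++ : (xs ys : List A) (f : A → ℕ) → sumOver (xs ++ ys) f ≡ sumOver xs f + sumOver ys f
  sumOver-++ []       ys f = refl
  sumOver-++ (x ∷ xs) ys f = trans (cong (f x +_) (sumOver-++ xs ys f)) (sym (+-assoc (f x) _ _))

  sumOver-const : (xs : List A) (c : ℕ) → sumOver xs (λ _ → c) ≡ length xs * c
  sumOver-const []       c = refl
  sumOver-const (x ∷ xs) c = cong (c +_) (sumOver-const xs c)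

module _ {a b} {A : Set a} {B : Set b} where

  sumOver-map : (g : A → B) (xs : List A) (f : B → ℕ) → sumOver (map g xs) f ≡ sumOver xs (f ∘ g)
  sumOver-map g []       f = refl
  sumOver-map g (x ∷ xs) f = cong (f (g x) +_) (sumOver-map g xs f)

  sumOver-concatMap : (g : A → List B) (xs : List A) (f : B → ℕ) →
    sumOver (concatMap g xs) f ≡ sumOver xs (λ x → sumOver (g x) f)
  sumOver-concatMap g []       f = refl
  sumOver-concatMap g (x ∷ xs) f =
    trans (sumOver-++ (g x) (concatMap g xs) f) (cong (sumOver (g x) f +_) (sumOver-concatMap g xs f))

sumOver-allFin : ∀ n (f : Fin n → ℕ) → sumOver (allFin n) f ≡ sum f
sumOver-allFin n f = go n (λ i → i)
  where
  go : ∀ n (g : Fin n → Fin _) → sumOver (tabulate g) f ≡ ∑[ i < n ] f (g i)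
  go zero    g = refl
  go (suc n) g = cong (f (g zero) +_) (go n (g ∘ suc))

count-filter : ∀ {a p} {A : Set a} {P : A → Set p} (P? : ∀ x → Dec (P x)) (xs : List A) →
  length (filter P? xs) ≡ sumOver xs (λ x → 𝟙 (does (P? x)))
count-filter P? []       = refl
count-filter P? (x ∷ xs) with does (P? x)
... | true  = cong suc (count-filter P? xs)
... | false = count-filter P? xs

sumOver-bound : ∀ {a} {A : Set a} (xs : List A) c d (f : A → ℕ) → (∀ x → c * f x ≤ d) → c * sumOver xs f ≤ length xs * d
sumOver-bound []       c d f bound = ≤-reflexive (*-zeroʳ c)
sumOver-bound (x ∷ xs) c d f bound = ≤-trans (≤-reflexive (*-distribˡ-+ c (f x) _)) (+-mono-≤ (bound x) (sumOver-bound xs c d f bound))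

∑-sumOver : ∀ {a} {A : Set a} n (xs : List A) (f : Fin n → A → ℕ) →
  ∑[ i < n ] sumOver xs (f i) ≡ sumOver xs (λ x → ∑[ i < n ] f i x)
∑-sumOver n []       f = sum-zero n (λ _ → refl)
∑-sumOver n (x ∷ xs) f = trans (∑-distrib-+ {n} (λ i → f i x) (λ i → sumOver xs (f i))) (cong (∑[ i < n ] f i x +_) (∑-sumOver n xs f))

∑⁴-sumOver : ∀ {a} {A : Set a} n (xs : List A) (f : Fin n → Fin n → Fin n → Fin n → A → ℕ) →
  ∑⁴ (λ a b c d → sumOver xs (f a b c d)) ≡ sumOver xs (λ x → ∑⁴ (λ a b c d → f a b c d x))
∑⁴-sumOver n xs f = trans
  (sum-cong-≗ {n} λ a → trans (sum-cong-≗ {n} λ b → trans (sum-cong-≗ {n} λ c → ∑-sumOver n xs (f a b c)) (∑-sumOver n xs _)) (∑-sumOver n xs _))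
  (∑-sumOver n xs _)

-- Sums over all permutations

permutations : (n : ℕ) → List (Permutation′ n)
permutations zero    = idₚ ∷ []
permutations (suc n) = concatMap (λ j → map (insert zero j) (permutations n)) (allFin (suc n))

∑ᴾ : ∀ n → (Permutation′ n → ℕ) → ℕ
∑ᴾ n = sumOver (permutations n)

∑ᴾ-cong : ∀ n {f g : Permutation′ n → ℕ} → (∀ π → f π ≡ g π) → ∑ᴾ n f ≡ ∑ᴾ n g
∑ᴾ-cong n = sumOver-cong (permutations n)

∑ᴾ-suc : ∀ n (g : Permutation′ (suc n) → ℕ) → ∑ᴾ (suc n) g ≡ ∑[ j < suc n ] ∑ᴾ n (g ∘ insert zero j)
∑ᴾ-suc n g = begin
  ∑ᴾ (suc n) g                                                   ≡⟨ sumOver-concatMap (λ j → map (insert zero j) (permutations n)) (allFin (suc n)) g ⟩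
  sumOver (allFin (suc n)) (λ j → sumOver (map (insert zero j) (permutations n)) g) ≡⟨ sumOver-allFin (suc n) _ ⟩
  ∑[ j < suc n ] sumOver (map (insert zero j) (permutations n)) g       ≡⟨ sum-cong-≗ (λ j → sumOver-map (insert zero j) (permutations n) g) ⟩
  ∑[ j < suc n ] ∑ᴾ n (g ∘ insert zero j)                        ∎
  where open ≡-Reasoning

∑ᴾ-const : ∀ n c → ∑ᴾ n (λ _ → c) ≡ n ! * c
∑ᴾ-const zero    c = refl
∑ᴾ-const (suc n) c = begin
  ∑ᴾ (suc n) (λ _ → c)          ≡⟨ ∑ᴾ-suc n _ ⟩
  ∑[ j < suc n ] ∑ᴾ n (λ _ → c) ≡⟨ sum-cong-≗ {suc n} (λ _ → ∑ᴾ-const n c) ⟩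
  ∑[ j < suc n ] (n ! * c)      ≡⟨ sum-const (suc n) (n ! * c) ⟩
  suc n * (n ! * c)             ≡⟨ *-assoc (suc n) (n !) c ⟨
  suc n ! * c                   ∎
  where open ≡-Reasoning

private
  *-pull : ∀ x y z → x * (y * z) ≡ y * x * z
  *-pull x y z = trans (sym (*-assoc x y z)) (cong (_* z) (*-comm x y))

∑ᴾ-image : ∀ n (a : Fin (suc n)) (h : Fin (suc n) → ℕ) →
  ∑ᴾ (suc n) (λ π → h (π ⟨$⟩ʳ a)) ≡ n ! * sum h
∑ᴾ-image n zero h = begin
  ∑ᴾ (suc n) (λ π → h (π ⟨$⟩ʳ zero))                       ≡⟨ ∑ᴾ-suc n _ ⟩
  ∑[ j < suc n ] ∑ᴾ n (λ _ → h j)                          ≡⟨ sum-cong-≗ (λ j → ∑ᴾ-const n (h j)) ⟩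
  ∑[ j < suc n ] (n ! * h j)                               ≡⟨ *-distribˡ-sum (n !) h ⟨
  n ! * sum h                                              ∎
  where open ≡-Reasoning
∑ᴾ-image (suc n) (suc a) h = begin
  ∑ᴾ (2 + n) (λ π → h (π ⟨$⟩ʳ suc a))                       ≡⟨ ∑ᴾ-suc (suc n) _ ⟩
  ∑[ j < 2 + n ] ∑ᴾ (suc n) (λ π → h (punchIn j (π ⟨$⟩ʳ a))) ≡⟨ sum-cong-≗ (λ j → ∑ᴾ-image n a (h ∘ punchIn j)) ⟩
  ∑[ j < 2 + n ] (n ! * sum (h ∘ punchIn j))               ≡⟨ *-distribˡ-sum (n !) (λ j → sum (h ∘ punchIn j)) ⟨
  n ! * ∑[ j < 2 + n ] sum (h ∘ punchIn j)                 ≡⟨ cong (n ! *_) (∑-sum-punchIn (suc n) h) ⟩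
  n ! * (suc n * sum h)                                    ≡⟨ *-pull (n !) (suc n) (sum h) ⟩
  suc n ! * sum h                                          ∎
  where open ≡-Reasoning

∑ᴾ-image₂ : ∀ n {a b : Fin (2 + n)} → a ≢ b →
  (h : Fin (2 + n) → Fin (2 + n) → ℕ) → (∀ x → h x x ≡ 0) →
  ∑ᴾ (2 + n) (λ π → h (π ⟨$⟩ʳ a) (π ⟨$⟩ʳ b)) ≡ n ! * ∑[ x < 2 + n ] ∑[ y < 2 + n ] h x y
∑ᴾ-image₂ n {zero} {zero} a≢b = ⊥-elim (a≢b refl)
∑ᴾ-image₂ n {zero} {suc b} _ h h-diag = begin
  ∑ᴾ (2 + n) (λ π → h (π ⟨$⟩ʳ zero) (π ⟨$⟩ʳ suc b))               ≡⟨ ∑ᴾ-suc (suc n) _ ⟩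
  ∑[ j < 2 + n ] ∑ᴾ (suc n) (λ π → h j (punchIn j (π ⟨$⟩ʳ b)))     ≡⟨ sum-cong-≗ (λ j → ∑ᴾ-image n b (h j ∘ punchIn j)) ⟩
  ∑[ j < 2 + n ] (n ! * sum (h j ∘ punchIn j))                     ≡⟨ sum-cong-≗ (λ j → cong (n ! *_) (sum-skip j {h j} (h-diag j))) ⟩
  ∑[ j < 2 + n ] (n ! * sum (h j))                                 ≡⟨ *-distribˡ-sum (n !) (λ j → sum (h j)) ⟨
  n ! * ∑[ x < 2 + n ] ∑[ y < 2 + n ] h x y                        ∎
  where open ≡-Reasoning
∑ᴾ-image₂ n {suc a} {zero} _ h h-diag = begin
  ∑ᴾ (2 + n) (λ π → h (π ⟨$⟩ʳ suc a) (π ⟨$⟩ʳ zero))               ≡⟨ ∑ᴾ-suc (suc n) _ ⟩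
  ∑[ j < 2 + n ] ∑ᴾ (suc n) (λ π → h (punchIn j (π ⟨$⟩ʳ a)) j)     ≡⟨ sum-cong-≗ (λ j → ∑ᴾ-image n a (λ x → h (punchIn j x) j)) ⟩
  ∑[ j < 2 + n ] (n ! * ∑[ x < 1 + n ] h (punchIn j x) j)          ≡⟨ sum-cong-≗ (λ j → cong (n ! *_) (sum-skip j {λ x → h x j} (h-diag j))) ⟩
  ∑[ j < 2 + n ] (n ! * ∑[ x < 2 + n ] h x j)                      ≡⟨ *-distribˡ-sum (n !) (λ j → ∑[ x < 2 + n ] h x j) ⟨
  n ! * ∑[ j < 2 + n ] ∑[ x < 2 + n ] h x j                        ≡⟨ cong (n ! *_) (∑-comm h) ⟨
  n ! * ∑[ x < 2 + n ] ∑[ y < 2 + n ] h x y                        ∎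
  where open ≡-Reasoning
∑ᴾ-image₂ zero {suc zero} {suc zero} a≢b = ⊥-elim (a≢b refl)
∑ᴾ-image₂ (suc n) {suc a} {suc b} a≢b h h-diag = begin
  ∑ᴾ (3 + n) (λ π → h (π ⟨$⟩ʳ suc a) (π ⟨$⟩ʳ suc b))              ≡⟨ ∑ᴾ-suc (2 + n) _ ⟩
  ∑[ j < 3 + n ] ∑ᴾ (2 + n) (λ π → h (punchIn j (π ⟨$⟩ʳ a)) (punchIn j (π ⟨$⟩ʳ b)))
    ≡⟨ sum-cong-≗ (λ j → ∑ᴾ-image₂ n (a≢b ∘ cong suc) (λ x y → h (punchIn j x) (punchIn j y)) (h-diag ∘ punchIn j)) ⟩
  ∑[ j < 3 + n ] (n ! * ∑[ x < 2 + n ] ∑[ y < 2 + n ] h (punchIn j x) (punchIn j y))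
    ≡⟨ *-distribˡ-sum (n !) (λ j → ∑[ x < 2 + n ] ∑[ y < 2 + n ] h (punchIn j x) (punchIn j y)) ⟨
  n ! * ∑[ j < 3 + n ] ∑[ x < 2 + n ] ∑[ y < 2 + n ] h (punchIn j x) (punchIn j y)
    ≡⟨ cong (n ! *_) (∑-sum-punchIn₂ (suc n) h h-diag) ⟩
  n ! * (suc n * ∑[ x < 3 + n ] ∑[ y < 3 + n ] h x y)             ≡⟨ *-pull (n !) (suc n) _ ⟩
  suc n ! * ∑[ x < 3 + n ] ∑[ y < 3 + n ] h x y                    ∎
  where open ≡-Reasoning

-- For e with ends at positions p₁, p₂ and f with ends at q₁, q₂ this is what
-- does (precedes? σ e f) computes to.
precedesᵇ : ℕ → ℕ → ℕ → ℕ → Bool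
precedesᵇ p₁ p₂ q₁ q₂ = (p₁ <ᵇ q₁) ∧ ((p₁ <ᵇ q₂) ∧ ((p₂ <ᵇ q₁) ∧ (p₂ <ᵇ q₂)))

separatesᵇ : ℕ → ℕ → ℕ → ℕ → Bool
separatesᵇ p₁ p₂ q₁ q₂ = precedesᵇ p₁ p₂ q₁ q₂ ∨ precedesᵇ q₁ q₂ p₁ p₂

posℕ : ∀ {m} → Ordering m → Vertex m → ℕ
posℕ σ = toℕ ∘ pos σ

precedesᵇ-asym : ∀ p₁ p₂ q₁ q₂ → precedesᵇ p₁ p₂ q₁ q₂ ≡ true → precedesᵇ q₁ q₂ p₁ p₂ ≡ false
precedesᵇ-asym p₁ p₂ q₁ q₂ prec with p₁ <? q₁
... | yes p₁<q₁ rewrite <ᵇ-false (<⇒≤ p₁<q₁) = refl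
... | no  p₁≮q₁ rewrite <ᵇ-false (≮⇒≥ p₁≮q₁) with () ← prec

𝟙-separatesᵇ : ∀ p₁ p₂ q₁ q₂ →
  𝟙 (separatesᵇ p₁ p₂ q₁ q₂) ≡ 𝟙 (precedesᵇ p₁ p₂ q₁ q₂) + 𝟙 (precedesᵇ q₁ q₂ p₁ p₂)
𝟙-separatesᵇ p₁ p₂ q₁ q₂ = 𝟙-∨ _ _ (precedesᵇ-asym p₁ p₂ q₁ q₂)

precedesᵇ-⊔ : ∀ p₁ p₂ q₁ q₂ → precedesᵇ p₁ p₂ q₁ q₂ ≡ (p₁ ⊔ p₂ <ᵇ q₁) ∧ (p₁ ⊔ p₂ <ᵇ q₂)
precedesᵇ-⊔ p₁ p₂ q₁ q₂ =
  trans (∧-interchange (p₁ <ᵇ q₁) (p₁ <ᵇ q₂) (p₂ <ᵇ q₁) (p₂ <ᵇ q₂)) (cong₂ _∧_ (⊔-<ᵇ p₁ p₂ q₁) (⊔-<ᵇ p₁ p₂ q₂))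

precedesᵇ-shared₁ : ∀ p₁ p₂ q₂ → precedesᵇ p₁ p₂ p₁ q₂ ≡ false
precedesᵇ-shared₁ p₁ p₂ q₂ rewrite <ᵇ-false (≤-refl {p₁}) = refl

precedesᵇ-shared₂ : ∀ p₁ p₂ q₁ → precedesᵇ p₁ p₂ q₁ p₂ ≡ false
precedesᵇ-shared₂ p₁ p₂ q₁ = trans (precedesᵇ-⊔ p₁ p₂ q₁ p₂)
  (trans (cong ((p₁ ⊔ p₂ <ᵇ q₁) ∧_) (<ᵇ-false (m≤n⊔m p₁ p₂))) (∧-zeroʳ _))

-- Alternating orderings

side↔ : ∀ {m} → Vertex m ↔ (Fin m × Fin 2)
side↔ = mk↔ₛ′ to from
  (λ { (a , zero) → refl ; (a , suc zero) → refl })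
  (λ { (inj₁ a) → refl ; (inj₂ a) → refl })
  where
  to : ∀ {m} → Vertex m → Fin m × Fin 2
  to (inj₁ a) = a , zero
  to (inj₂ a) = a , suc zero
  from : ∀ {m} → Fin m × Fin 2 → Vertex m
  from (a , zero)     = inj₁ a
  from (a , suc zero) = inj₂ a

cast↔ : ∀ {m n} → m ≡ n → Fin m ↔ Fin n
cast↔ eq = mk↔ₛ′ (cast eq) (cast (sym eq)) (cast-involutive eq (sym eq)) (cast-involutive (sym eq) eq)

-- Left vertex a goes to position 2a, right vertex c to position 2c + 1.
interleave : ∀ {m} → Vertex m ↔ Fin (m + m)
interleave {m} = cast↔ (trans (*-comm m 2) (cong (m +_) (+-identityʳ m))) ↔-∘ (↔-sym *↔× ↔-∘ side↔)

alternating : ∀ {m} → Permutation′ m → Permutation′ m → Ordering m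
alternating π ρ = interleave ↔-∘ (π ⊎-↔ ρ)

posℕ-alternating-left : ∀ {m} (π ρ : Permutation′ m) a → posℕ (alternating π ρ) (inj₁ a) ≡ 2 * toℕ (π ⟨$⟩ʳ a)
posℕ-alternating-left π ρ a =
  trans (toℕ-cast _ _) (trans (toℕ-combine (π ⟨$⟩ʳ a) zero) (+-identityʳ _))

posℕ-alternating-right : ∀ {m} (π ρ : Permutation′ m) c → posℕ (alternating π ρ) (inj₂ c) ≡ suc (2 * toℕ (ρ ⟨$⟩ʳ c))
posℕ-alternating-right π ρ c =
  trans (toℕ-cast _ _) (trans (toℕ-combine (ρ ⟨$⟩ʳ c) (suc zero)) (+-comm _ 1))

precedesᵇ-alternating : ∀ x y u v →
  precedesᵇ (2 * x) (suc (2 * u)) (2 * y) (suc (2 * v)) ≡ (x <ᵇ y ⊓ suc v) ∧ (u <ᵇ y ⊓ v)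
precedesᵇ-alternating x y u v = begin
  (2 * x <ᵇ 2 * y) ∧ ((2 * x <ᵇ suc (2 * v)) ∧ ((suc (2 * u) <ᵇ 2 * y) ∧ (2 * u <ᵇ 2 * v)))
    ≡⟨ cong₂ _∧_ (even<even x y) (cong₂ _∧_ (even<odd x v) (cong₂ _∧_ (odd<even u y) (even<even u v))) ⟩
  (x <ᵇ y) ∧ ((x <ᵇ suc v) ∧ ((u <ᵇ y) ∧ (u <ᵇ v)))  ≡⟨ ∧-assoc (x <ᵇ y) (x <ᵇ suc v) _ ⟨
  ((x <ᵇ y) ∧ (x <ᵇ suc v)) ∧ ((u <ᵇ y) ∧ (u <ᵇ v))  ≡⟨ cong₂ _∧_ (⊓-<ᵇ x y (suc v)) (⊓-<ᵇ u y v) ⟩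
  (x <ᵇ y ⊓ suc v) ∧ (u <ᵇ y ⊓ v)                    ∎
  where
  open ≡-Reasoning
  even<even : ∀ x y → (2 * x <ᵇ 2 * y) ≡ (x <ᵇ y)
  even<even x y = <ᵇ-cong (*-cancelˡ-< 2 x y) (*-monoʳ-< 2)
  even<odd : ∀ x v → (2 * x <ᵇ suc (2 * v)) ≡ (x <ᵇ suc v)
  even<odd x v = <ᵇ-cong {2 * x} {suc (2 * v)} {x} {suc v} (s≤s ∘ *-cancelˡ-≤ 2 ∘ ≤-pred) (s≤s ∘ *-monoʳ-≤ 2 ∘ ≤-pred)
  odd<even : ∀ u y → (suc (2 * u) <ᵇ 2 * y) ≡ (u <ᵇ y)
  odd<even u y = <ᵇ-cong {suc (2 * u)} {2 * y} {u} {y} (*-cancelˡ-< 2 u y ∘ ≤-trans (n≤1+n _))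
    (λ u<y → subst (_≤ 2 * y) (*-distribˡ-+ 2 1 u) (*-monoʳ-≤ 2 u<y))

alternatingSep : ∀ {m} → Fin m → Fin m → Fin m → Fin m → ℕ
alternatingSep x y u v = 𝟙 (separatesᵇ (2 * toℕ x) (suc (2 * toℕ u)) (2 * toℕ y) (suc (2 * toℕ v)))

alternatingSep-left : ∀ {m} (x u v : Fin m) → alternatingSep x x u v ≡ 0
alternatingSep-left x u v rewrite precedesᵇ-shared₁ (2 * toℕ x) (suc (2 * toℕ u)) (suc (2 * toℕ v))
                                | precedesᵇ-shared₁ (2 * toℕ x) (suc (2 * toℕ v)) (suc (2 * toℕ u)) = refl

alternatingSep-right : ∀ {m} (x y u : Fin m) → alternatingSep x y u u ≡ 0
alternatingSep-right x y u rewrite precedesᵇ-shared₂ (2 * toℕ x) (suc (2 * toℕ u)) (2 * toℕ y)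
                                 | precedesᵇ-shared₂ (2 * toℕ y) (suc (2 * toℕ u)) (2 * toℕ x) = refl

separates-alternating : ∀ {m} (π ρ : Permutation′ m) (a c b d : Fin m) →
  𝟙 (does (separates? (a , c) (b , d) (alternating π ρ))) ≡ alternatingSep (π ⟨$⟩ʳ a) (π ⟨$⟩ʳ b) (ρ ⟨$⟩ʳ c) (ρ ⟨$⟩ʳ d)
separates-alternating π ρ a c b d
  rewrite posℕ-alternating-left π ρ a | posℕ-alternating-left π ρ b
        | posℕ-alternating-right π ρ c | posℕ-alternating-right π ρ d = refl

alternatingPrecedences : ℕ → ℕ
alternatingPrecedences m = ∑[ y < m ] ∑[ v < m ] ((toℕ y ⊓ suc (toℕ v)) * (toℕ y ⊓ toℕ v))

∑-precedes-alternating : ∀ M →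
  ∑⁴ {M} (λ x y u v → 𝟙 (precedesᵇ (2 * toℕ x) (suc (2 * toℕ u)) (2 * toℕ y) (suc (2 * toℕ v)))) ≡ alternatingPrecedences M
∑-precedes-alternating M = begin
  ∑⁴ {M} (λ x y u v → 𝟙 (precedesᵇ (2 * toℕ x) (suc (2 * toℕ u)) (2 * toℕ y) (suc (2 * toℕ v))))
    ≡⟨ ∑⁴-cong {M} (λ x y u v → trans (cong 𝟙 (precedesᵇ-alternating (toℕ x) (toℕ y) (toℕ u) (toℕ v)))
                                   (𝟙-∧ (toℕ x <ᵇ toℕ y ⊓ suc (toℕ v)) (toℕ u <ᵇ toℕ y ⊓ toℕ v))) ⟩
  (∑[ x < M ] ∑[ y < M ] ∑[ u < M ] ∑[ v < M ] (A x y v * B u y v))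
    ≡⟨ ∑-comm {M} {M} _ ⟩
  (∑[ y < M ] ∑[ x < M ] ∑[ u < M ] ∑[ v < M ] (A x y v * B u y v))
    ≡⟨ sum-cong-≗ {M} (λ y → sum-cong-≗ {M} λ x → ∑-comm {M} {M} _) ⟩
  (∑[ y < M ] ∑[ x < M ] ∑[ v < M ] ∑[ u < M ] (A x y v * B u y v))
    ≡⟨ sum-cong-≗ {M} (λ y → ∑-comm {M} {M} _) ⟩
  (∑[ y < M ] ∑[ v < M ] ∑[ x < M ] ∑[ u < M ] (A x y v * B u y v))
    ≡⟨ sum-cong-≗ {M} (λ y → sum-cong-≗ {M} λ v → sym (∑-*-∑ (λ x → A x y v) (λ u → B u y v))) ⟩
  (∑[ y < M ] ∑[ v < M ] (∑[ x < M ] A x y v * ∑[ u < M ] B u y v))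
    ≡⟨ sum-cong-≗ {M} (λ y → sum-cong-≗ {M} λ v → cong₂ _*_ (∑-<ᵇ M _ (⊓≤ y)) (∑-<ᵇ M _ (⊓≤ y))) ⟩
  alternatingPrecedences M ∎
  where
  open ≡-Reasoning
  A B : Fin M → Fin M → Fin M → ℕ
  A x y v = 𝟙 (toℕ x <ᵇ toℕ y ⊓ suc (toℕ v))
  B u y v = 𝟙 (toℕ u <ᵇ toℕ y ⊓ toℕ v)
  ⊓≤ : ∀ (y : Fin M) {z} → toℕ y ⊓ z ≤ M
  ⊓≤ y {z} = ≤-trans (m⊓n≤m (toℕ y) z) (<⇒≤ (toℕ<n y))

∑-alternatingSep : ∀ M → ∑⁴ (alternatingSep {M}) ≡ 2 * alternatingPrecedences M
∑-alternatingSep M = begin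
  ∑⁴ (alternatingSep {M})               ≡⟨ ∑⁴-cong {M} (λ x y u v → 𝟙-separatesᵇ (2 * toℕ x) (suc (2 * toℕ u)) (2 * toℕ y) (suc (2 * toℕ v))) ⟩
  ∑⁴ (λ x y u v → P x y u v + P y x v u) ≡⟨ ∑⁴-distrib-+ P (λ x y u v → P y x v u) ⟩
  ∑⁴ P + ∑⁴ (λ x y u v → P y x v u)     ≡⟨ cong (∑⁴ P +_) (∑⁴-swap P) ⟩
  ∑⁴ P + ∑⁴ P                           ≡⟨ cong₂ _+_ (∑-precedes-alternating M) (trans (∑-precedes-alternating M) (sym (+-identityʳ _))) ⟩
  2 * alternatingPrecedences M          ∎
  where
  open ≡-Reasoning
  P : Fin M → Fin M → Fin M → Fin M → ℕ
  P x y u v = 𝟙 (precedesᵇ (2 * toℕ x) (suc (2 * toℕ u)) (2 * toℕ y) (suc (2 * toℕ v)))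

alternatingPrecedences-suc : ∀ m → alternatingPrecedences (suc m)
  ≡ alternatingPrecedences m + ∑[ i < m ] (toℕ i * toℕ i) + (∑[ i < m ] (suc (toℕ i) * toℕ i) + m * m)
alternatingPrecedences-suc m = begin
  alternatingPrecedences (suc m)
    ≡⟨ sum-cong-≗ {suc m} (λ y → ∑-toℕ-last m (F (toℕ y))) ⟩
  ∑[ y < suc m ] (∑[ v < m ] F (toℕ y) (toℕ v) + F (toℕ y) m)
    ≡⟨ ∑-toℕ-last m (λ y → ∑[ v < m ] F y (toℕ v) + F y m) ⟩
  ∑[ y < m ] (∑[ v < m ] F (toℕ y) (toℕ v) + F (toℕ y) m) + (∑[ v < m ] F m (toℕ v) + F m m)
    ≡⟨ cong (_+ (∑[ v < m ] F m (toℕ v) + F m m)) (∑-distrib-+ {m} _ (λ y → F (toℕ y) m)) ⟩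
  alternatingPrecedences m + ∑[ y < m ] F (toℕ y) m + (∑[ v < m ] F m (toℕ v) + F m m)
    ≡⟨ cong₂ (λ a b → alternatingPrecedences m + a + b) (sum-cong-≗ {m} last-column) (cong₂ _+_ (sum-cong-≗ {m} last-row) corner) ⟩
  alternatingPrecedences m + ∑[ i < m ] (toℕ i * toℕ i) + (∑[ i < m ] (suc (toℕ i) * toℕ i) + m * m)
    ∎
  where
  open ≡-Reasoning
  F : ℕ → ℕ → ℕ
  F y v = (y ⊓ suc v) * (y ⊓ v)
  last-column : ∀ (y : Fin m) → F (toℕ y) m ≡ toℕ y * toℕ y
  last-column y = cong₂ _*_ (m≤n⇒m⊓n≡m (≤-trans (<⇒≤ (toℕ<n y)) (n≤1+n m))) (m≤n⇒m⊓n≡m (<⇒≤ (toℕ<n y)))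
  last-row : ∀ (v : Fin m) → F m (toℕ v) ≡ suc (toℕ v) * toℕ v
  last-row v = cong₂ _*_ (m≥n⇒m⊓n≡n (toℕ<n v)) (m≥n⇒m⊓n≡n (<⇒≤ (toℕ<n v)))
  corner : F m m ≡ m * m
  corner = cong₂ _*_ (m≤n⇒m⊓n≡m (n≤1+n m)) (⊓-idem m)

alternatingPrecedences-closed : ∀ k → 6 * alternatingPrecedences (suc k) ≡ suc k * (k * k) * (2 + k)
alternatingPrecedences-closed zero    = refl
alternatingPrecedences-closed (suc k) = begin
  6 * alternatingPrecedences (2 + k)
    ≡⟨ cong (6 *_) (alternatingPrecedences-suc (suc k)) ⟩
  6 * (A + S + (P + suc k * suc k))
    ≡⟨ distribute A S P (suc k * suc k) ⟩
  6 * A + 6 * S + (2 * (3 * P) + 6 * (suc k * suc k))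
    ≡⟨ cong₂ (λ a s → a + s + (2 * (3 * P) + 6 * (suc k * suc k))) (alternatingPrecedences-closed k) (∑-square k) ⟩
  suc k * (k * k) * (2 + k) + k * suc k * (1 + 2 * k) + (2 * (3 * P) + 6 * (suc k * suc k))
    ≡⟨ cong (λ p → suc k * (k * k) * (2 + k) + k * suc k * (1 + 2 * k) + (2 * p + 6 * (suc k * suc k))) (∑-pronic k) ⟩
  suc k * (k * k) * (2 + k) + k * suc k * (1 + 2 * k) + (2 * (k * suc k * (2 + k)) + 6 * (suc k * suc k))
    ≡⟨ solve (k ∷ []) ⟩
  (2 + k) * (suc k * suc k) * (3 + k)
    ∎
  where
  open ≡-Reasoning
  A = alternatingPrecedences (suc k)
  S = ∑[ i < suc k ] (toℕ i * toℕ i)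
  P = ∑[ i < suc k ] (suc (toℕ i) * toℕ i)
  distribute : ∀ a s p q → 6 * (a + s + (p + q)) ≡ 6 * a + 6 * s + (2 * (3 * p) + 6 * q)
  distribute = solve-∀

alternatingPrecedences-positive : ∀ k → 1 ≤ alternatingPrecedences (2 + k)
alternatingPrecedences-positive k =
  n≢0⇒n>0 (λ zero-pairs → case trans (sym (alternatingPrecedences-closed (suc k))) (cong (6 *_) zero-pairs) of λ ())

module AlternatingFamily (n : ℕ) where

  orderings : List (Ordering (2 + n))
  orderings = concatMap (λ π → map (alternating π) (permutations (2 + n))) (permutations (2 + n))

  sumOver-orderings : ∀ (g : Ordering (2 + n) → ℕ) →
    sumOver orderings g ≡ ∑ᴾ (2 + n) (λ π → ∑ᴾ (2 + n) (λ ρ → g (alternating π ρ)))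
  sumOver-orderings g = trans (sumOver-concatMap (λ π → map (alternating π) (permutations (2 + n))) (permutations (2 + n)) g)
    (∑ᴾ-cong (2 + n) (λ π → sumOver-map (alternating π) (permutations (2 + n)) g))

  length-orderings : length orderings ≡ (2 + n) ! * (2 + n) !
  length-orderings = begin
    length orderings                              ≡⟨ *-identityʳ _ ⟨
    length orderings * 1                          ≡⟨ sumOver-const orderings 1 ⟨
    sumOver orderings (λ _ → 1)                   ≡⟨ sumOver-orderings (λ _ → 1) ⟩
    ∑ᴾ (2 + n) (λ _ → ∑ᴾ (2 + n) (λ _ → 1))       ≡⟨ ∑ᴾ-cong (2 + n) (λ _ → ∑ᴾ-const (2 + n) 1) ⟩
    ∑ᴾ (2 + n) (λ _ → (2 + n) ! * 1)              ≡⟨ ∑ᴾ-const (2 + n) _ ⟩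
    (2 + n) ! * ((2 + n) ! * 1)                   ≡⟨ cong ((2 + n) ! *_) (*-identityʳ _) ⟩
    (2 + n) ! * (2 + n) !                         ∎
    where open ≡-Reasoning

  separations : ℕ
  separations = n ! * (n ! * (2 * alternatingPrecedences (2 + n)))

  sepCount-orderings : ∀ {a b c d} → a ≢ b → c ≢ d → sepCount orderings (a , c) (b , d) ≡ separations
  sepCount-orderings {a} {b} {c} {d} a≢b c≢d = begin
    sepCount orderings (a , c) (b , d)
      ≡⟨ count-filter (separates? (a , c) (b , d)) orderings ⟩
    sumOver orderings (λ σ → 𝟙 (does (separates? (a , c) (b , d) σ)))
      ≡⟨ sumOver-orderings _ ⟩
    ∑ᴾ (2 + n) (λ π → ∑ᴾ (2 + n) (λ ρ → 𝟙 (does (separates? (a , c) (b , d) (alternating π ρ)))))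
      ≡⟨ ∑ᴾ-cong (2 + n) (λ π → ∑ᴾ-cong (2 + n) (λ ρ → separates-alternating π ρ a c b d)) ⟩
    ∑ᴾ (2 + n) (λ π → ∑ᴾ (2 + n) (λ ρ → alternatingSep (π ⟨$⟩ʳ a) (π ⟨$⟩ʳ b) (ρ ⟨$⟩ʳ c) (ρ ⟨$⟩ʳ d)))
      ≡⟨ ∑ᴾ-cong (2 + n) (λ π → ∑ᴾ-image₂ n c≢d (alternatingSep (π ⟨$⟩ʳ a) (π ⟨$⟩ʳ b)) (alternatingSep-right (π ⟨$⟩ʳ a) (π ⟨$⟩ʳ b))) ⟩
    ∑ᴾ (2 + n) (λ π → n ! * I (π ⟨$⟩ʳ a) (π ⟨$⟩ʳ b))
      ≡⟨ ∑ᴾ-image₂ n a≢b (λ x y → n ! * I x y)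
           (λ x → trans (cong (n ! *_) (sum-zero (2 + n) λ u → sum-zero (2 + n) λ v → alternatingSep-left x u v))
                        (*-zeroʳ (n !))) ⟩
    n ! * ∑[ x < 2 + n ] ∑[ y < 2 + n ] (n ! * I x y)
      ≡⟨ cong (n ! *_) (trans (sum-cong-≗ {2 + n} (λ x → sym (*-distribˡ-sum (n !) (I x)))) (sym (*-distribˡ-sum (n !) (λ x → sum (I x))))) ⟩
    n ! * (n ! * ∑⁴ (alternatingSep {2 + n}))
      ≡⟨ cong (λ s → n ! * (n ! * s)) (∑-alternatingSep (2 + n)) ⟩
    separations
      ∎
    where
    open ≡-Reasoning
    I : Fin (2 + n) → Fin (2 + n) → ℕ
    I x y = ∑[ u < 2 + n ] ∑[ v < 2 + n ] alternatingSep x y u v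

  length-orderings-ratio : length orderings * (2 + n + 1) ≡ 3 * (2 + n) * separations
  length-orderings-ratio = begin
    length orderings * (2 + n + 1)                                ≡⟨ cong₂ _*_ length-orderings (+-comm (2 + n) 1) ⟩
    (2 + n) ! * (2 + n) ! * (3 + n)                               ≡⟨ factorials n (n !) ⟩
    (2 + n) * (n ! * n !) * ((2 + n) * (suc n * suc n) * (3 + n)) ≡⟨ cong ((2 + n) * (n ! * n !) *_) (alternatingPrecedences-closed (suc n)) ⟨
    (2 + n) * (n ! * n !) * (6 * alternatingPrecedences (2 + n))  ≡⟨ regroup (2 + n) (n !) (alternatingPrecedences (2 + n)) ⟩
    3 * (2 + n) * separations                                     ∎
    where
    open ≡-Reasoning
    factorials : ∀ n f → (2 + n) * (suc n * f) * ((2 + n) * (suc n * f)) * (3 + n)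
                       ≡ (2 + n) * (f * f) * ((2 + n) * (suc n * suc n) * (3 + n))
    factorials = solve-∀
    regroup : ∀ m f w → m * (f * f) * (6 * w) ≡ 3 * m * (f * (f * (2 * w)))
    regroup = solve-∀

  upper-bound : Σ (List (Ordering (2 + n))) λ L → Σ ℕ λ b →
    (1 ≤ b) × SeparatesAll L b × (length L * (2 + n + 1) ≡ 3 * (2 + n) * b)
  upper-bound = orderings , separations
    , *-mono-≤ (1≤n! n) (*-mono-≤ (1≤n! n) (*-mono-≤ {1} {2} (s≤s z≤n) (alternatingPrecedences-positive n)))
    , (λ { (a , c) (b , d) (a≢b , c≢d) → ≤-reflexive (sym (sepCount-orderings a≢b c≢d)) })
    , length-orderings-ratio

-- Preceding pairs in an arbitrary ordering

module _ {m : ℕ} (p : Fin m → ℕ) where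

  before after at : ℕ → ℕ
  before t = ∑[ a < m ] 𝟙 (p a <ᵇ t)
  after  t = ∑[ a < m ] 𝟙 (t <ᵇ p a)
  at     t = ∑[ a < m ] 𝟙 (p a ≡ᵇ t)

  ∑before : (ℕ → ℕ) → ℕ → ℕ
  ∑before f t = ∑[ a < m ] (𝟙 (p a <ᵇ t) * f (p a))

  before-suc : ∀ t → before (suc t) ≡ before t + at t
  before-suc t = trans (sum-cong-≗ {m} (λ a → 𝟙-<ᵇ-suc (p a) t)) (∑-distrib-+ {m} _ _)

  ∑before-suc : ∀ f t → ∑before f (suc t) ≡ ∑before f t + at t * f t
  ∑before-suc f t = begin
    ∑before f (suc t)                                                    ≡⟨ sum-cong-≗ {m} (λ a → cong (_* f (p a)) (𝟙-<ᵇ-suc (p a) t)) ⟩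
    ∑[ a < m ] ((𝟙 (p a <ᵇ t) + 𝟙 (p a ≡ᵇ t)) * f (p a))                 ≡⟨ sum-cong-≗ {m} (λ a → *-distribʳ-+ (f (p a)) (𝟙 (p a <ᵇ t)) _) ⟩
    ∑[ a < m ] (𝟙 (p a <ᵇ t) * f (p a) + 𝟙 (p a ≡ᵇ t) * f (p a))         ≡⟨ ∑-distrib-+ {m} _ _ ⟩
    ∑before f t + ∑[ a < m ] (𝟙 (p a ≡ᵇ t) * f (p a))                    ≡⟨ cong (∑before f t +_) (sum-cong-≗ {m} (λ a → 𝟙-≡ᵇ-subst (p a) t f)) ⟩
    ∑before f t + ∑[ a < m ] (𝟙 (p a ≡ᵇ t) * f t)                        ≡⟨ cong (∑before f t +_) (*-distribʳ-sum (f t) (λ a → 𝟙 (p a ≡ᵇ t))) ⟨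
    ∑before f t + at t * f t                                             ∎
    where open ≡-Reasoning

  before+after+at : ∀ t → before t + after t + at t ≡ m
  before+after+at t = begin
    before t + after t + at t                                        ≡⟨ cong (_+ at t) (∑-distrib-+ {m} _ _) ⟨
    ∑[ a < m ] (𝟙 (p a <ᵇ t) + 𝟙 (t <ᵇ p a)) + at t                  ≡⟨ ∑-distrib-+ {m} _ _ ⟨
    ∑[ a < m ] (𝟙 (p a <ᵇ t) + 𝟙 (t <ᵇ p a) + 𝟙 (p a ≡ᵇ t))         ≡⟨ sum-cong-≗ {m} (λ a → 𝟙-trichotomy (p a) t) ⟩
    ∑[ a < m ] 1                                                     ≡⟨ trans (sum-const m 1) (*-identityʳ m) ⟩
    m                                                                ∎
    where open ≡-Reasoning

  before-bound : ∀ t → (∀ a → p a < t) → before t ≡ m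
  before-bound t p<t = trans (sum-cong-≗ {m} (λ a → cong 𝟙 (<ᵇ-true (p<t a)))) (trans (sum-const m 1) (*-identityʳ m))

  ∑before-bound : ∀ f t → (∀ a → p a < t) → ∑before f t ≡ ∑[ a < m ] f (p a)
  ∑before-bound f t p<t = sum-cong-≗ {m} (λ a → trans (cong (λ b → 𝟙 b * f (p a)) (<ᵇ-true (p<t a))) (+-identityʳ _))

  before-zero : before 0 ≡ 0
  before-zero = sum-zero m (λ _ → refl)

  ∑before-zero : ∀ f → ∑before f 0 ≡ 0
  ∑before-zero f = sum-zero m (λ _ → refl)

module PrecedingPairs {m : ℕ} (σ : Ordering m) where

  pL pR : Fin m → ℕ
  pL a = posℕ σ (inj₁ a)
  pR c = posℕ σ (inj₂ c)

  posℕ-injective : ∀ {v w} → posℕ σ v ≡ posℕ σ w → v ≡ w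
  posℕ-injective {v} {w} eq = begin
    v                            ≡⟨ Inverse.strictlyInverseʳ σ v ⟨
    Inverse.from σ (pos σ v)     ≡⟨ cong (Inverse.from σ) (toℕ-injective eq) ⟩
    Inverse.from σ (pos σ w)     ≡⟨ Inverse.strictlyInverseʳ σ w ⟩
    w                            ∎
    where open ≡-Reasoning

  pL≢pR : ∀ a c → pL a ≢ pR c
  pL≢pR a c eq with () ← posℕ-injective eq

  edgesAfter : ℕ → ℕ
  edgesAfter t = after pL t * after pR t

  costL costR : ℕ → ℕ
  costL t = before pR t * edgesAfter t
  costR t = before pL t * edgesAfter t

  precedingPairs : ℕ
  precedingPairs = ∑⁴ (λ a b c d → 𝟙 (does (precedes? σ (a , c) (b , d))))

  -- An edge precedes f iff its later end does; grouping edges by their later end gives the costs.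
  precedingPairs-costs : precedingPairs ≡ ∑[ a < m ] costL (pL a) + ∑[ c < m ] costR (pR c)
  precedingPairs-costs = begin
    precedingPairs
      ≡⟨ sum-cong-≗ {m} (λ a → ∑-comm {m} {m} _) ⟩
    ∑[ a < m ] ∑[ c < m ] ∑[ b < m ] ∑[ d < m ] 𝟙 (does (precedes? σ (a , c) (b , d)))
      ≡⟨ sum-cong-≗ {m} (λ a → sum-cong-≗ {m} λ c → later-end (pL a ⊔ pR c)
           (λ b d → trans (cong 𝟙 (precedesᵇ-⊔ (pL a) (pR c) (pL b) (pR d))) (𝟙-∧ (pL a ⊔ pR c <ᵇ pL b) (pL a ⊔ pR c <ᵇ pR d)))) ⟩
    ∑[ a < m ] ∑[ c < m ] edgesAfter (pL a ⊔ pR c)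
      ≡⟨ sum-cong-≗ {m} (λ a → sum-cong-≗ {m} λ c → max-split (pL a) (pR c) edgesAfter (pL≢pR a c)) ⟩
    ∑[ a < m ] ∑[ c < m ] (𝟙 (pR c <ᵇ pL a) * edgesAfter (pL a) + 𝟙 (pL a <ᵇ pR c) * edgesAfter (pR c))
      ≡⟨ trans (sum-cong-≗ {m} (λ a → ∑-distrib-+ {m} _ _)) (∑-distrib-+ {m} _ _) ⟩
    ∑[ a < m ] ∑[ c < m ] (𝟙 (pR c <ᵇ pL a) * edgesAfter (pL a)) + ∑[ a < m ] ∑[ c < m ] (𝟙 (pL a <ᵇ pR c) * edgesAfter (pR c))
      ≡⟨ cong₂ _+_ (sum-cong-≗ {m} (λ a → sym (*-distribʳ-sum (edgesAfter (pL a)) (λ c → 𝟙 (pR c <ᵇ pL a)))))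
                   (trans (∑-comm {m} {m} _) (sum-cong-≗ {m} (λ c → sym (*-distribʳ-sum (edgesAfter (pR c)) (λ a → 𝟙 (pL a <ᵇ pR c)))))) ⟩
    ∑[ a < m ] costL (pL a) + ∑[ c < m ] costR (pR c)
      ∎
    where
    open ≡-Reasoning
    later-end : ∀ t {g : Fin m → Fin m → ℕ} → (∀ b d → g b d ≡ 𝟙 (t <ᵇ pL b) * 𝟙 (t <ᵇ pR d)) →
      ∑[ b < m ] ∑[ d < m ] g b d ≡ edgesAfter t
    later-end t g≡ = trans (sum-cong-≗ {m} λ b → sum-cong-≗ {m} λ d → g≡ b d)
                           (sym (∑-*-∑ (λ b → 𝟙 (t <ᵇ pL b)) (λ d → 𝟙 (t <ᵇ pR d))))

  -- Counts the pairs (e , f) with e preceding f and both ends of e before position t.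
  progress : ℕ → ℕ
  progress t = ∑before pL costL t + ∑before pR costR t

  progress-zero : progress 0 ≡ 0
  progress-zero = cong₂ _+_ (∑before-zero pL costL) (∑before-zero pR costR)

  progress-suc : ∀ t → progress (suc t) ≡ progress t + (at pL t * costL t + at pR t * costR t)
  progress-suc t = trans (cong₂ _+_ (∑before-suc pL costL t) (∑before-suc pR costR t))
    (+-assoc-middle (∑before pL costL t) (at pL t * costL t) (∑before pR costR t) (at pR t * costR t))
    where +-assoc-middle : ∀ a b c d → a + b + (c + d) ≡ a + c + (b + d)
          +-assoc-middle = solve-∀

  pos<end : ∀ v → posℕ σ v < m + m
  pos<end v = toℕ<n (pos σ v)

  progress-end : progress (m + m) ≡ precedingPairs
  progress-end = trans (cong₂ _+_ (∑before-bound pL costL (m + m) (pos<end ∘ inj₁))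
                                  (∑before-bound pR costR (m + m) (pos<end ∘ inj₂)))
                       (sym precedingPairs-costs)

  occupancy : ∀ t → t < m + m → at pL t + at pR t ≡ 1
  occupancy t t<2m = trans (∑-vertex-point v₀ (λ v → 𝟙 (posℕ σ v ≡ᵇ t)) elsewhere) (trans (cong (λ x → 𝟙 (x ≡ᵇ t)) pos-v₀) (𝟙-≡ᵇ-refl t))
    where
    v₀ = Inverse.from σ (fromℕ< t<2m)
    pos-v₀ : posℕ σ v₀ ≡ t
    pos-v₀ = trans (cong toℕ (Inverse.strictlyInverseˡ σ (fromℕ< t<2m))) (toℕ-fromℕ< t<2m)
    elsewhere : ∀ v → v ≢ v₀ → 𝟙 (posℕ σ v ≡ᵇ t) ≡ 0
    elsewhere v v≢v₀ = 𝟙-≡ᵇ-≢ (posℕ σ v) t (λ eq → v≢v₀ (posℕ-injective (trans eq (sym pos-v₀))))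

module Potential where

  open import Data.Integer using (+_; -[1+_])
  open import Data.Vec using (_∷_; [])

  -- The terms without J are six times the cost of the alternating walk from (0 , 0) to (I , I);
  -- the last term vanishes on the diagonal.
  potential : ∀ {n} → Polynomial n → Polynomial n → Polynomial n → Polynomial n
  potential M I J =
    I :- I :* M :- con (+ 3) :* I :^ 2 :* M :+ con (+ 6) :* I :^ 2 :* M :^ 2 :+ con (+ 2) :* I :^ 3
    :- con (+ 8) :* I :^ 3 :* M :+ con (+ 3) :* I :^ 4
    :+ con (+ 3) :* I :* (M :- I) :* (J :- I) :* (con (+ 2) :* M :- I :- J :- con (+ 1))

  Φ : ℤ → ℤ → ℤ → ℤ
  Φ M I J = ⟦ potential (var zero) (var (suc zero)) (var (suc (suc zero))) ⟧ (M ∷ I ∷ J ∷ [])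

  Φ-origin : ∀ M → Φ M (+ 0) (+ 0) ≡ + 0
  Φ-origin = solveℤ 1 (λ M → potential M (con (+ 0)) (con (+ 0)) := con (+ 0)) refl

  Φ-diagonal : ∀ M → Φ M M M ≡ M ℤ.* ((M ℤ.- + 1) ℤ.* (M ℤ.- + 1)) ℤ.* (M ℤ.+ + 1)
  Φ-diagonal = solveℤ 1 (λ M → potential M M M := M :* ((M :- con (+ 1)) :* (M :- con (+ 1))) :* (M :+ con (+ 1))) refl

  Φ-left-step : ∀ I A J →
    Φ (I ℤ.+ A ℤ.+ + 1) (I ℤ.+ + 1) J
      ≡ + 6 ℤ.* (J ℤ.* (A ℤ.* (I ℤ.+ A ℤ.+ + 1 ℤ.- J))) ℤ.+ Φ (I ℤ.+ A ℤ.+ + 1) I J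
        ℤ.+ + 3 ℤ.* (I ℤ.+ A) ℤ.* ((J ℤ.- I) ℤ.* (J ℤ.- I ℤ.- + 1))
  Φ-left-step = solveℤ 3 (λ I A J → let M = I :+ A :+ con (+ 1) in
    potential M (I :+ con (+ 1)) J
      := con (+ 6) :* (J :* (A :* (M :- J))) :+ potential M I J :+ con (+ 3) :* (I :+ A) :* ((J :- I) :* (J :- I :- con (+ 1))))
    refl

  Φ-right-step : ∀ I J B →
    Φ (J ℤ.+ B ℤ.+ + 1) I (J ℤ.+ + 1) ≡ + 6 ℤ.* (I ℤ.* ((J ℤ.+ B ℤ.+ + 1 ℤ.- I) ℤ.* B)) ℤ.+ Φ (J ℤ.+ B ℤ.+ + 1) I J
  Φ-right-step = solveℤ 3 (λ I J B → let M = J :+ B :+ con (+ 1) in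
    potential M I (J :+ con (+ 1)) := con (+ 6) :* (I :* ((M :- I) :* B)) :+ potential M I J)
    refl

  consecutive-product : ∀ z → Σ ℕ λ p → z ℤ.* (z ℤ.- + 1) ≡ + p
  consecutive-product (+ zero)  = 0 , refl
  consecutive-product (+ suc n) = suc n * n , sym (ℤₚ.pos-* (suc n) n)
  consecutive-product -[1+ n ]  = suc n * suc (suc n) , cong (λ k → + (suc n * suc (suc k))) (+-identityʳ n)

  pos-difference : ∀ {x y z} → x + y ≡ z → + y ≡ + z ℤ.- + x
  pos-difference {x} {y} refl = solveℤ 2 (λ x y → y := x :+ y :- x) refl (+ x) (+ y)

  pos-*₃ : ∀ c x y z → + (c * (x * (y * z))) ≡ + c ℤ.* (+ x ℤ.* (+ y ℤ.* + z))
  pos-*₃ c x y z = trans (ℤₚ.pos-* c _) (cong (+ c ℤ.*_) (trans (ℤₚ.pos-* x _) (cong (+ x ℤ.*_) (ℤₚ.pos-* y z))))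

  pos-6*-split : ∀ s c → + (6 * (s + c)) ≡ + (6 * c) ℤ.+ + (6 * s)
  pos-6*-split s c = cong ℤ.+_ (trans (*-distribˡ-+ 6 s c) (+-comm (6 * s) (6 * c)))

  pos-diagonal : ∀ m → + m ℤ.* ((+ m ℤ.- + 1) ℤ.* (+ m ℤ.- + 1)) ℤ.* (+ m ℤ.+ + 1) ≡ + (m * ((m ∸ 1) * (m ∸ 1)) * (m + 1))
  pos-diagonal zero    = refl
  pos-diagonal (suc k) = sym (trans (ℤₚ.pos-* (suc k * (k * k)) (suc k + 1))
    (cong (ℤ._* + (suc k + 1)) (trans (ℤₚ.pos-* (suc k) (k * k)) (cong (+ suc k ℤ.*_) (ℤₚ.pos-* k k)))))

  Φ-left : ∀ {m i j a b} → i + a + 1 ≡ m → j + b ≡ m →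
    + (6 * (j * (a * b))) ℤ.+ Φ (+ m) (+ i) (+ j) ℤ.≤ Φ (+ m) (+ suc i) (+ j)
  Φ-left {_} {i} {j} {a} {b} refl j+b≡m = begin
    + (6 * (j * (a * b))) ℤ.+ Φ M I J
      ≡⟨ cong (ℤ._+ Φ M I J) (trans (pos-*₃ 6 j a b) (cong (λ x → + 6 ℤ.* (J ℤ.* (A ℤ.* x))) (pos-difference {j} {b} j+b≡m))) ⟩
    + 6 ℤ.* (J ℤ.* (A ℤ.* (M ℤ.- J))) ℤ.+ Φ M I J
      ≤⟨ ℤₚ.i≤i+j _ (+ (3 * ((i + a) * p))) ⟩
    + 6 ℤ.* (J ℤ.* (A ℤ.* (M ℤ.- J))) ℤ.+ Φ M I J ℤ.+ + (3 * ((i + a) * p))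
      ≡⟨ cong (λ x → + 6 ℤ.* (J ℤ.* (A ℤ.* (M ℤ.- J))) ℤ.+ Φ M I J ℤ.+ x) extra ⟩
    + 6 ℤ.* (J ℤ.* (A ℤ.* (M ℤ.- J))) ℤ.+ Φ M I J ℤ.+ + 3 ℤ.* (I ℤ.+ A) ℤ.* ((J ℤ.- I) ℤ.* (J ℤ.- I ℤ.- + 1))
      ≡⟨ Φ-left-step I A J ⟨
    Φ M (I ℤ.+ + 1) J
      ≡⟨ cong (λ k → Φ M (+ k) J) (+-comm i 1) ⟩
    Φ M (+ suc i) J
      ∎
    where
    open ℤₚ.≤-Reasoning
    I = + i
    J = + j
    A = + a
    M = + (i + a + 1)
    p = proj₁ (consecutive-product (J ℤ.- I))
    extra : + (3 * ((i + a) * p)) ≡ + 3 ℤ.* (I ℤ.+ A) ℤ.* ((J ℤ.- I) ℤ.* (J ℤ.- I ℤ.- + 1))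
    extra = trans (ℤₚ.pos-* 3 ((i + a) * p)) (trans (cong (+ 3 ℤ.*_) (ℤₚ.pos-* (i + a) p))
      (trans (sym (ℤₚ.*-assoc (+ 3) (I ℤ.+ A) (+ p))) (cong (+ 3 ℤ.* (I ℤ.+ A) ℤ.*_) (sym (proj₂ (consecutive-product (J ℤ.- I)))))))

  Φ-right : ∀ {m i j a b} → i + a ≡ m → j + b + 1 ≡ m →
    + (6 * (i * (a * b))) ℤ.+ Φ (+ m) (+ i) (+ j) ≡ Φ (+ m) (+ i) (+ suc j)
  Φ-right {_} {i} {j} {a} {b} i+a≡m refl = begin
    + (6 * (i * (a * b))) ℤ.+ Φ M I J
      ≡⟨ cong (ℤ._+ Φ M I J) (trans (pos-*₃ 6 i a b) (cong (λ x → + 6 ℤ.* (I ℤ.* (x ℤ.* B))) (pos-difference {i} {a} i+a≡m))) ⟩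
    + 6 ℤ.* (I ℤ.* ((M ℤ.- I) ℤ.* B)) ℤ.+ Φ M I J
      ≡⟨ Φ-right-step I J B ⟨
    Φ M I (J ℤ.+ + 1)
      ≡⟨ cong (λ k → Φ M I (+ k)) (+-comm j 1) ⟩
    Φ M I (+ suc j)
      ∎
    where
    open ≡-Reasoning
    I = + i
    J = + j
    B = + b
    M = + (j + b + 1)

  module Walk {m : ℕ} (σ : Ordering m) where
    open PrecedingPairs σ

    Invariant : ℕ → Set
    Invariant t = + (6 * progress t) ℤ.≤ Φ (+ m) (+ before pL t) (+ before pR t)

    invariant-zero : Invariant 0
    invariant-zero = ℤₚ.≤-reflexive (begin
      + (6 * progress 0)                    ≡⟨ cong (λ s → + (6 * s)) progress-zero ⟩
      + 0                                   ≡⟨ Φ-origin (+ m) ⟨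
      Φ (+ m) (+ 0) (+ 0)                   ≡⟨ cong₂ (λ i j → Φ (+ m) (+ i) (+ j)) (before-zero pL) (before-zero pR) ⟨
      Φ (+ m) (+ before pL 0) (+ before pR 0) ∎)
      where open ≡-Reasoning

    left-step : ∀ t → at pL t ≡ 1 → at pR t ≡ 0 → Invariant t → Invariant (suc t)
    left-step t atL≡1 atR≡0 inv = begin
      + (6 * progress (suc t))                          ≡⟨ cong (λ s → + (6 * s)) progress≡ ⟩
      + (6 * (progress t + costL t))                    ≡⟨ pos-6*-split (progress t) (costL t) ⟩
      + (6 * costL t) ℤ.+ + (6 * progress t)            ≤⟨ ℤₚ.+-monoʳ-≤ (+ (6 * costL t)) inv ⟩
      + (6 * costL t) ℤ.+ Φ (+ m) (+ i) (+ j)           ≤⟨ Φ-left {m} {i} {j} {after pL t} {after pR t} i+a+1≡m j+b≡m ⟩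
      Φ (+ m) (+ suc i) (+ j)                           ≡⟨ cong₂ (λ i j → Φ (+ m) (+ i) (+ j)) i≡ j≡ ⟨
      Φ (+ m) (+ before pL (suc t)) (+ before pR (suc t)) ∎
      where
      open ℤₚ.≤-Reasoning
      i = before pL t
      j = before pR t
      progress≡ : progress (suc t) ≡ progress t + costL t
      progress≡ = trans (progress-suc t) (cong (λ x → progress t + x)
        (trans (cong₂ (λ x y → x * costL t + y * costR t) atL≡1 atR≡0) (trans (+-identityʳ _) (*-identityˡ _))))
      i≡ : before pL (suc t) ≡ suc i
      i≡ = trans (before-suc pL t) (trans (cong (λ x → i + x) atL≡1) (+-comm i 1))
      j≡ : before pR (suc t) ≡ j
      j≡ = trans (before-suc pR t) (trans (cong (λ x → j + x) atR≡0) (+-identityʳ j))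
      i+a+1≡m : i + after pL t + 1 ≡ m
      i+a+1≡m = trans (cong (λ x → i + after pL t + x) (sym atL≡1)) (before+after+at pL t)
      j+b≡m : j + after pR t ≡ m
      j+b≡m = trans (sym (+-identityʳ _)) (trans (cong (λ x → j + after pR t + x) (sym atR≡0)) (before+after+at pR t))

    right-step : ∀ t → at pL t ≡ 0 → at pR t ≡ 1 → Invariant t → Invariant (suc t)
    right-step t atL≡0 atR≡1 inv = begin
      + (6 * progress (suc t))                          ≡⟨ cong (λ s → + (6 * s)) progress≡ ⟩
      + (6 * (progress t + costR t))                    ≡⟨ pos-6*-split (progress t) (costR t) ⟩
      + (6 * costR t) ℤ.+ + (6 * progress t)            ≤⟨ ℤₚ.+-monoʳ-≤ (+ (6 * costR t)) inv ⟩
      + (6 * costR t) ℤ.+ Φ (+ m) (+ i) (+ j)           ≡⟨ Φ-right {m} {i} {j} {after pL t} {after pR t} i+a≡m j+b+1≡m ⟩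
      Φ (+ m) (+ i) (+ suc j)                           ≡⟨ cong₂ (λ i j → Φ (+ m) (+ i) (+ j)) i≡ j≡ ⟨
      Φ (+ m) (+ before pL (suc t)) (+ before pR (suc t)) ∎
      where
      open ℤₚ.≤-Reasoning
      i = before pL t
      j = before pR t
      progress≡ : progress (suc t) ≡ progress t + costR t
      progress≡ = trans (progress-suc t) (cong (λ x → progress t + x)
        (trans (cong₂ (λ x y → x * costL t + y * costR t) atL≡0 atR≡1) (*-identityˡ _)))
      i≡ : before pL (suc t) ≡ i
      i≡ = trans (before-suc pL t) (trans (cong (λ x → i + x) atL≡0) (+-identityʳ i))
      j≡ : before pR (suc t) ≡ suc j
      j≡ = trans (before-suc pR t) (trans (cong (λ x → j + x) atR≡1) (+-comm j 1))
      i+a≡m : i + after pL t ≡ m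
      i+a≡m = trans (sym (+-identityʳ _)) (trans (cong (λ x → i + after pL t + x) (sym atL≡0)) (before+after+at pL t))
      j+b+1≡m : j + after pR t + 1 ≡ m
      j+b+1≡m = trans (cong (λ x → j + after pR t + x) (sym atR≡1)) (before+after+at pR t)

    invariant-suc : ∀ t → t < m + m → Invariant t → Invariant (suc t)
    invariant-suc t t<2m with +-≡1-cases (occupancy t t<2m)
    ... | inj₁ (atL≡1 , atR≡0) = left-step t atL≡1 atR≡0
    ... | inj₂ (atL≡0 , atR≡1) = right-step t atL≡0 atR≡1

    invariant : ∀ t → t ≤ m + m → Invariant t
    invariant zero    _    = invariant-zero
    invariant (suc t) t<2m = invariant-suc t t<2m (invariant t (<⇒≤ t<2m))

    precedingPairs-bound : 6 * precedingPairs ≤ m * ((m ∸ 1) * (m ∸ 1)) * (m + 1)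
    precedingPairs-bound = ℤₚ.drop‿+≤+ (begin
      + (6 * precedingPairs)                             ≡⟨ cong (λ s → + (6 * s)) progress-end ⟨
      + (6 * progress (m + m))                           ≤⟨ invariant (m + m) ≤-refl ⟩
      Φ (+ m) (+ before pL (m + m)) (+ before pR (m + m)) ≡⟨ cong₂ (λ i j → Φ (+ m) (+ i) (+ j))
                                                              (before-bound pL (m + m) (pos<end ∘ inj₁))
                                                              (before-bound pR (m + m) (pos<end ∘ inj₂)) ⟩
      Φ (+ m) (+ m) (+ m)                                ≡⟨ Φ-diagonal (+ m) ⟩
      + m ℤ.* ((+ m ℤ.- + 1) ℤ.* (+ m ℤ.- + 1)) ℤ.* (+ m ℤ.+ + 1) ≡⟨ pos-diagonal m ⟩
      + (m * ((m ∸ 1) * (m ∸ 1)) * (m + 1))              ∎)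
      where open ℤₚ.≤-Reasoning

open Potential.Walk using (precedingPairs-bound)

open PrecedingPairs using (precedingPairs)

separatingPairs : ∀ {m} → Ordering m → ℕ
separatingPairs σ = ∑⁴ (λ a b c d → 𝟙 (does (separates? (a , c) (b , d) σ)))

separatingPairs≡2*precedingPairs : ∀ {m} (σ : Ordering m) → separatingPairs σ ≡ 2 * precedingPairs σ
separatingPairs≡2*precedingPairs σ = begin
  separatingPairs σ                           ≡⟨ ∑⁴-cong (λ a b c d → 𝟙-separatesᵇ (p (inj₁ a)) (p (inj₂ c)) (p (inj₁ b)) (p (inj₂ d))) ⟩
  ∑⁴ (λ a b c d → P a b c d + P b a d c)      ≡⟨ ∑⁴-distrib-+ P (λ a b c d → P b a d c) ⟩
  ∑⁴ P + ∑⁴ (λ a b c d → P b a d c)           ≡⟨ cong (∑⁴ P +_) (∑⁴-swap P) ⟩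
  ∑⁴ P + ∑⁴ P                                 ≡⟨ cong (∑⁴ P +_) (+-identityʳ (∑⁴ P)) ⟨
  2 * precedingPairs σ                        ∎
  where
  open ≡-Reasoning
  p = posℕ σ
  P = λ a b c d → 𝟙 (does (precedes? σ (a , c) (b , d)))

separatingPairs-bound : ∀ {m} (σ : Ordering m) → 3 * separatingPairs σ ≤ m * ((m ∸ 1) * (m ∸ 1)) * (m + 1)
separatingPairs-bound σ = ≤-trans
  (≤-reflexive (trans (cong (3 *_) (separatingPairs≡2*precedingPairs σ)) (sym (*-assoc 3 2 (precedingPairs σ)))))
  (precedingPairs-bound σ)

∑-sepCount : ∀ {m} (L : List (Ordering m)) →
  ∑⁴ (λ a b c d → sepCount L (a , c) (b , d)) ≡ sumOver L separatingPairs
∑-sepCount {m} L = trans (∑⁴-cong λ a b c d → count-filter (separates? (a , c) (b , d)) L)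
                         (∑⁴-sumOver m L (λ a b c d σ → 𝟙 (does (separates? (a , c) (b , d) σ))))

-- The left-hand side counts the m²(m − 1)² nonincident pairs, indexed through punchIn.
∑-sepCount-≥ : ∀ k (L : List (Ordering (suc k))) b → SeparatesAll L b →
  suc k * (k * (suc k * (k * b))) ≤ ∑⁴ (λ a b c d → sepCount L (a , c) (b , d))
∑-sepCount-≥ k L b separated = begin
  m * (k * (m * (k * b)))                                               ≡⟨ constant ⟨
  ∑[ a < m ] ∑[ b′ < k ] ∑[ c < m ] ∑[ d′ < k ] b
    ≤⟨ sum-mono {m} (λ a → sum-mono {k} λ b′ → sum-mono {m} λ c → sum-mono {k} λ d′ →
         separated (a , c) (punchIn a b′ , punchIn c d′) (punchInᵢ≢i a b′ ∘ sym , punchInᵢ≢i c d′ ∘ sym)) ⟩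
  ∑[ a < m ] ∑[ b′ < k ] ∑[ c < m ] ∑[ d′ < k ] count a (punchIn a b′) c (punchIn c d′)
    ≤⟨ sum-mono {m} (λ a → ≤-trans
         (sum-mono {k} λ b′ → sum-mono {m} λ c → sum-punchIn-≤ c (count a (punchIn a b′) c))
         (sum-punchIn-≤ a (λ b → ∑[ c < m ] ∑[ d < m ] count a b c d))) ⟩
  ∑⁴ count                                                              ∎
  where
  open ≤-Reasoning
  m = suc k
  count : Fin m → Fin m → Fin m → Fin m → ℕ
  count a b c d = sepCount L (a , c) (b , d)
  constant : ∑[ a < m ] ∑[ b′ < k ] ∑[ c < m ] ∑[ d′ < k ] b ≡ m * (k * (m * (k * b)))
  constant = trans (sum-cong-≗ {m} λ _ → trans (sum-cong-≗ {k} λ _ → trans (sum-cong-≗ {m} λ _ → sum-const k b)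
                                                                             (sum-const m (k * b)))
                                                  (sum-const k (m * (k * b))))
                   (sum-const m (k * (m * (k * b))))

lower-bound : ∀ n (L : List (Ordering (2 + n))) b → SeparatesAll L b → 3 * (2 + n) * b ≤ length L * (2 + n + 1)
lower-bound n L b separated = *-cancelʳ-≤ (3 * m * b) (length L * (m + 1)) (m * (k * k)) (begin
  3 * m * b * (m * (k * k))                                   ≡⟨ regroup m k b ⟩
  3 * (m * (k * (m * (k * b))))                               ≤⟨ *-monoʳ-≤ 3 (∑-sepCount-≥ k L b separated) ⟩
  3 * ∑⁴ (λ a b c d → sepCount L (a , c) (b , d))             ≡⟨ cong (3 *_) (∑-sepCount L) ⟩
  3 * sumOver L separatingPairs                               ≤⟨ sumOver-bound L 3 _ separatingPairs separatingPairs-bound ⟩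
  length L * (m * (k * k) * (m + 1))                          ≡⟨ rearrange (length L) m k ⟩
  length L * (m + 1) * (m * (k * k))                          ∎)
  where
  open ≤-Reasoning
  m k : ℕ
  m = 2 + n
  k = 1 + n
  regroup : ∀ m k b → 3 * m * b * (m * (k * k)) ≡ 3 * (m * (k * (m * (k * b))))
  regroup = solve-∀
  rearrange : ∀ l m k → l * (m * (k * k) * (m + 1)) ≡ l * (m + 1) * (m * (k * k))
  rearrange = solve-∀

mainTheorem3 : (m : ℕ) → 2 ≤ m → FracSepDimIs m (3 * m) (m + 1)
mainTheorem3 (suc (suc n)) _ = AlternatingFamily.upper-bound n , λ L b _ → lower-bound n L b
mainTheorem3 (suc zero) (s≤s ())
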